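{- Let $\Pi$ be an STR derivation of $\Gamma\vdash M:\{\sigma_1,\dots,\sigma_n\}$. Then there exist a term $N$ and STR derivations $\Pi_i$ of $\Gamma_i\vdash N:\sigma_i$ ($1\le i\le n$) such that $\Pi$ consists of an application of rule (st) with premises $\Pi_1,\dots,\Pi_n$, followed by a (possibly empty) sequence of applications of the renaming rules (w) and (m).
   Context: Terms: $M ::= x \mid \lambda x.M \mid MM$ modulo $\alpha$-equivalence. STR types: linear $A ::= a \mid \sigma\multimap A \mid \forall a.A$, stratified $\sigma ::= A \mid \{\sigma_1,\dots,\sigma_n\}$ ($n\ge1$), modulo renaming of bound type variables and the congruence treating $\{\sigma_1,\dots,\sigma_n\}$ as a finite set (no identification of $\{\sigma\}$ with $\sigma$). Contexts are finite partial maps from term variables to types. Rules ($A,B$ linear): (Ax) $x:A\vdash x:A$; (w) from $\Gamma\vdash M:\sigma$, $x\notin dom(\Gamma)$, infer $\Gamma,x:A\vdash M:\sigma$; ($\multimap$I) from $\Gamma,x:\sigma\vdash M:B$ infer $\Gamma\vdash\lambda x.M:\sigma\multimap B$; ($\multimap$E) from $\Gamma_1\vdash M:\sigma\multimap A$, $\Gamma_2\vdash N:\sigma$ with disjoint domains infer $\Gamma_1,\Gamma_2\vdash MN:A$; (m) from $\Gamma,x_1:\sigma_1,\dots,x_n:\sigma_n\vdash M:\tau$ infer $\Gamma,x:\{\sigma_1,\dots,\sigma_n\}\vdash M[x/x_1,\dots,x/x_n]:\tau$; (st) from $\Gamma_i\vdash M:\sigma_i$ ($1\le i\le n$), all $\Gamma_i$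 with the same domain, infer $\bigcup_i\{\Gamma_i\}\vdash M:\{\sigma_1,\dots,\sigma_n\}$, where $(\bigcup_i\{\Gamma_i\})(x)=\{\Gamma_1(x),\dots,\Gamma_n(x)\}$; ($\forall$I) from $\Gamma\vdash M:A$, $a$ not free in $\Gamma$, infer $\Gamma\vdash M:\forall a.A$; ($\forall$E) from $\Gamma\vdash M:\forall a.B$ infer $\Gamma\vdash M:B[A/a]$, $A$ linear. -}

module Defs where

open import Data.Nat using (ℕ; zero; suc; _≡ᵇ_)
import Data.Nat as ℕ
open import Data.Fin using (Fin; zero; suc; fromℕ; inject₁; toℕ; lower₁)
open import Data.Bool using (Bool; true; false; if_then_else_; _∨_)
open import Data.Maybe using (Maybe; just; nothing; _<∣>_)
open import Data.Product using (Σ; _×_; _,_)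
open import Data.Sum using (_⊎_)
open import Relation.Binary.PropositionalEquality using (_≡_; _≗_; sym)
open import Relation.Nullary using (yes; no)

private variable n : ℕ

-- Locally nameless: free type variables are names (ℕ), bound
-- type variables are de Bruijn indices (innermost binder = zero), and
-- Lin n / Str n are types under n enclosing ∀-binders.  This makes
-- renaming of bound type variables syntactic identity.
-- A set type {σ_1,…,σ_n} (n ≥ 1) is  set k σ  with n = suc k and
-- σ : Fin (suc k) → Str.

mutual
  data Lin (n : ℕ) : Set where
    tfv : ℕ → Lin n
    tbv : Fin n → Lin n
    _⊸_ : Str n → Lin n → Lin n
    all : Lin (suc n) → Lin n

  data Str (n : ℕ) : Set where
    lin : Lin n → Str n
    set : (k : ℕ) → (Fin (suc k) → Str n) → Str n

-- The congruence treating {σ_1,…,σ_n} as a finite set (extensional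
-- set equality, recursively); no identification of {σ} with σ.
mutual
  data _≅L_ {n : ℕ} : Lin n → Lin n → Set where
    tfv≅ : ∀ a → tfv a ≅L tfv a
    tbv≅ : ∀ i → tbv i ≅L tbv i
    ⊸≅   : ∀ {σ σ' A A'} → σ ≅S σ' → A ≅L A' → (σ ⊸ A) ≅L (σ' ⊸ A')
    all≅ : ∀ {A A'} → A ≅L A' → all A ≅L all A'

  data _≅S_ {n : ℕ} : Str n → Str n → Set where
    lin≅ : ∀ {A A'} → A ≅L A' → lin A ≅S lin A'
    set≅ : ∀ {k l} {σ : Fin (suc k) → Str n} {τ : Fin (suc l) → Str n} →
           (∀ i → Σ (Fin (suc l)) λ j → σ i ≅S τ j) →
           (∀ j → Σ (Fin (suc k)) λ i → σ i ≅S τ j) →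
           set k σ ≅S set l τ

anyFin : (k : ℕ) → (Fin k → Bool) → Bool
anyFin zero    f = false
anyFin (suc k) f = f zero ∨ anyFin k (λ i → f (suc i))

mutual
  weakL : Lin n → Lin (suc n)
  weakL (tfv a)   = tfv a
  weakL (tbv i)   = tbv (inject₁ i)
  weakL (σ ⊸ A)   = weakS σ ⊸ weakL A
  weakL (all B)   = all (weakL B)

  weakS : Str n → Str (suc n)
  weakS (lin A)   = lin (weakL A)
  weakS (set k σ) = set k (λ i → weakS (σ i))

wk0 : (n : ℕ) → Lin 0 → Lin n
wk0 zero    A = A
wk0 (suc n) A = weakL (wk0 n A)

-- B[A/a] where a is the variable bound by an outermost ∀ (index n at depth n)
instVar : (n : ℕ) → Lin 0 → Fin (suc n) → Lin n
instVar n A i with n ℕ.≟ toℕ i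
... | yes _ = wk0 n A
... | no ne = tbv (lower₁ i ne)

mutual
  instL : Lin 0 → Lin (suc n) → Lin n
  instL A (tfv a) = tfv a
  instL {n} A (tbv i) = instVar n A i
  instL A (σ ⊸ B) = instS A σ ⊸ instL A B
  instL A (all B) = all (instL A B)

  instS : Lin 0 → Str (suc n) → Str n
  instS A (lin B)   = lin (instL A B)
  instS A (set k σ) = set k (λ i → instS A (σ i))

-- abstracting the free type variable a (for ∀ a . A)
mutual
  closeL : ℕ → Lin n → Lin (suc n)
  closeL {n} a (tfv b) = if a ≡ᵇ b then tbv (fromℕ n) else tfv b
  closeL a (tbv i) = tbv (inject₁ i)
  closeL a (σ ⊸ B) = closeS a σ ⊸ closeL a B
  closeL a (all B) = all (closeL a B)

  closeS : ℕ → Str n → Str (suc n)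
  closeS a (lin B)   = lin (closeL a B)
  closeS a (set k σ) = set k (λ i → closeS a (σ i))

mutual
  occL : ℕ → Lin n → Bool
  occL a (tfv b) = a ≡ᵇ b
  occL a (tbv i) = false
  occL a (σ ⊸ B) = occS a σ ∨ occL a B
  occL a (all B) = occL a B

  occS : ℕ → Str n → Bool
  occS a (lin B)   = occL a B
  occS a (set k σ) = anyFin (suc k) (λ i → occS a (σ i))

-- Terms modulo α (locally nameless: free variables are names ℕ,
-- bound variables de Bruijn indices).

data Tm (n : ℕ) : Set where
  fv  : ℕ → Tm n
  bv  : Fin n → Tm n
  lam : Tm (suc n) → Tm n
  app : Tm n → Tm n → Tm n

-- λx.M  is  lam (closeT x M)
closeT : ℕ → Tm n → Tm (suc n)
closeT {n} x (fv y) = if x ≡ᵇ y then bv (fromℕ n) else fv y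
closeT x (bv i)    = bv (inject₁ i)
closeT x (lam M)   = lam (closeT x M)
closeT x (app M N) = app (closeT x M) (closeT x N)

renT : (ℕ → ℕ) → Tm n → Tm n
renT f (fv y)    = fv (f y)
renT f (bv i)    = bv i
renT f (lam M)   = lam (renT f M)
renT f (app M N) = app (renT f M) (renT f N)

isIn : (k : ℕ) → (Fin k → ℕ) → ℕ → Bool
isIn k xs y = anyFin k (λ i → xs i ≡ᵇ y)

renameTo : ℕ → (k : ℕ) → (Fin (suc k) → ℕ) → ℕ → ℕ
renameTo x k xs y = if isIn (suc k) xs y then x else y

Ctx : Set
Ctx = ℕ → Maybe (Str 0)

emptyCtx : Ctx
emptyCtx _ = nothing

extend : Ctx → ℕ → Str 0 → Ctx
extend Γ x σ y = if y ≡ᵇ x then just σ else Γ y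

Disjoint : Ctx → Ctx → Set
Disjoint Γ₁ Γ₂ = ∀ y → (Γ₁ y ≡ nothing) ⊎ (Γ₂ y ≡ nothing)

merge : Ctx → Ctx → Ctx
merge Γ₁ Γ₂ y = Γ₁ y <∣> Γ₂ y

NotFreeCtx : ℕ → Ctx → Set
NotFreeCtx a Γ = ∀ y τ → Γ y ≡ just τ → occS a τ ≡ false

-- Γ (all Γs i having the same domain) is  ⋃_i {Γs i}
IsUnion : Ctx → (k : ℕ) → (Fin (suc k) → Ctx) → Set
IsUnion Γ k Γs = ∀ y →
  ((Γ y ≡ nothing) × (∀ i → Γs i y ≡ nothing)) ⊎
  (Σ (Fin (suc k) → Str 0) λ τ → (∀ i → Γs i y ≡ just (τ i)) × (Γ y ≡ just (set k τ)))

-- Γp is  Γ₀, x_1:σ_1, …, x_n:σ_n  (x_i distinct, not in dom Γ₀)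
IsMExt : Ctx → Ctx → (k : ℕ) → (Fin (suc k) → ℕ) → (Fin (suc k) → Str 0) → Set
IsMExt Γp Γ₀ k xs σ =
  (∀ i j → xs i ≡ xs j → i ≡ j) ×
  (∀ i → Γ₀ (xs i) ≡ nothing) ×
  (∀ i → Γp (xs i) ≡ just (σ i)) ×
  (∀ y → isIn (suc k) xs y ≡ false → Γp y ≡ Γ₀ y)

infix 4 _⊢_∶_
data _⊢_∶_ : Ctx → Tm 0 → Str 0 → Set where
  ax  : ∀ {Γ} x (A : Lin 0) → Γ ≗ extend emptyCtx x (lin A) → Γ ⊢ fv x ∶ lin A
  w   : ∀ {Γ Γ' M σ} x (A : Lin 0) → Γ ⊢ M ∶ σ → Γ x ≡ nothing →
        Γ' ≗ extend Γ x (lin A) → Γ' ⊢ M ∶ σ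
  ⊸I  : ∀ {Γ Γ' M} x (σ : Str 0) (B : Lin 0) → Γ' ⊢ M ∶ lin B → Γ x ≡ nothing →
        Γ' ≗ extend Γ x σ → Γ ⊢ lam (closeT x M) ∶ lin (σ ⊸ B)
  ⊸E  : ∀ {Γ Γ₁ Γ₂ M N} {σ σ' : Str 0} {A : Lin 0} →
        Γ₁ ⊢ M ∶ lin (σ ⊸ A) → Γ₂ ⊢ N ∶ σ' → σ ≅S σ' →
        Disjoint Γ₁ Γ₂ → Γ ≗ merge Γ₁ Γ₂ → Γ ⊢ app M N ∶ lin A
  m   : ∀ {Γp Γ₀ Γ M τ} x k (xs : Fin (suc k) → ℕ) (σ : Fin (suc k) → Str 0) →
        Γp ⊢ M ∶ τ → IsMExt Γp Γ₀ k xs σ → Γ₀ x ≡ nothing →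
        Γ ≗ extend Γ₀ x (set k σ) → Γ ⊢ renT (renameTo x k xs) M ∶ τ
  st  : ∀ {Γ M} k (Γs : Fin (suc k) → Ctx) (σ : Fin (suc k) → Str 0) →
        (∀ i → Γs i ⊢ M ∶ σ i) → IsUnion Γ k Γs → Γ ⊢ M ∶ set k σ
  ∀I  : ∀ {Γ M} a (A : Lin 0) → Γ ⊢ M ∶ lin A → NotFreeCtx a Γ →
        Γ ⊢ M ∶ lin (all (closeL a A))
  ∀E  : ∀ {Γ M} (B : Lin 1) (A : Lin 0) → Γ ⊢ M ∶ lin (all B) →
        Γ ⊢ M ∶ lin (instL A B)

data Reaches {Γ₀ N τ} (Π₀ : Γ₀ ⊢ N ∶ τ) : ∀ {Γ M} → Γ ⊢ M ∶ τ → Set where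
  done : Reaches Π₀ Π₀
  viaW : ∀ {Γ Γ' M} {x A} {Π : Γ ⊢ M ∶ τ} {p} {q : Γ' ≗ extend Γ x (lin A)} →
         Reaches Π₀ Π → Reaches Π₀ (w x A Π p q)
  viaM : ∀ {Γp Γ₁ Γ M} {x k xs σ} {Π : Γp ⊢ M ∶ τ} {e} {p}
           {q : Γ ≗ extend Γ₁ x (set k σ)} →
         Reaches Π₀ Π → Reaches Π₀ (m x k xs σ Π e p q)

module Submission where

-- Of the STR rules, (Ax), (⊸I),
-- (⊸E), (∀I) and (∀E) all conclude a linear type.  A derivation whose
-- conclusion is a set type {σ_1,…,σ_n} must therefore end with (st),
-- (w) or (m).  The renaming rules (w) and (m) keep the type of their
-- premise, so peeling them off one by one eventually reaches an
-- application of (st).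

open import Defs
open import Data.Nat using (ℕ; suc)
open import Data.Fin using (Fin)
open import Data.Maybe using (nothing)
open import Data.Product using (Σ; _,_)
open import Relation.Binary.PropositionalEquality using (_≡_; _≗_)

StDecomposition : ∀ {Γ : Ctx} {M : Tm 0} {k : ℕ} {σ : Fin (suc k) → Str 0} →
                  Γ ⊢ M ∶ set k σ → Set
StDecomposition {Γ} {M} {k} {σ} Π =
  Σ (Tm 0) λ N →
  Σ (Fin (suc k) → Ctx) λ Γs →
  Σ (∀ i → Γs i ⊢ N ∶ σ i) λ Πs →
  Σ Ctx λ Γ₀ →
  Σ (IsUnion Γ₀ k Γs) λ u →
  Reaches (st k Γs σ Πs u) Π

st-decomposes : ∀ {Γ M} k (Γs : Fin (suc k) → Ctx) (σ : Fin (suc k) → Str 0)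
                (Πs : ∀ i → Γs i ⊢ M ∶ σ i) (u : IsUnion Γ k Γs) →
                StDecomposition (st k Γs σ Πs u)
st-decomposes {Γ} {M} k Γs σ Πs u = M , Γs , Πs , Γ , u , done

w-decomposes : ∀ {Γ Γ' M k} {σ : Fin (suc k) → Str 0} x (A : Lin 0)
               {Π : Γ ⊢ M ∶ set k σ} (p : Γ x ≡ nothing)
               (q : Γ' ≗ extend Γ x (lin A)) →
               StDecomposition Π → StDecomposition (w x A Π p q)
w-decomposes x A p q (N , Γs , Πs , Γ₀ , u , r) = N , Γs , Πs , Γ₀ , u , viaW r

m-decomposes : ∀ {Γp Γ₁ Γ M l} {τ : Fin (suc l) → Str 0} x k
               (xs : Fin (suc k) → ℕ) (σ : Fin (suc k) → Str 0)
               {Π : Γp ⊢ M ∶ set l τ} (e : IsMExt Γp Γ₁ k xs σ)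
               (p : Γ₁ x ≡ nothing) (q : Γ ≗ extend Γ₁ x (set k σ)) →
               StDecomposition Π → StDecomposition (m x k xs σ Π e p q)
m-decomposes x k xs σ e p q (N , Γs , Πs , Γ₀ , u , r) = N , Γs , Πs , Γ₀ , u , viaM r

-- Theorem 13: every derivation of a set type decomposes.  The rules
-- concluding a linear type do not match the index set k σ, so only
-- (w), (m) and (st) need to be considered.
mainTheorem13 : ∀ {Γ : Ctx} {M : Tm 0} {k : ℕ} {σ : Fin (suc k) → Str 0}
    (Π : Γ ⊢ M ∶ set k σ) →
    Σ (Tm 0) λ N →
    Σ (Fin (suc k) → Ctx) λ Γs →
    Σ (∀ i → Γs i ⊢ N ∶ σ i) λ Πs →
    Σ Ctx λ Γ₀ →
    Σ (IsUnion Γ₀ k Γs) λ u →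
    Reaches (st k Γs σ Πs u) Π
mainTheorem13 (st k Γs σ Πs u)       = st-decomposes k Γs σ Πs u
mainTheorem13 (w x A Π p q)          = w-decomposes x A p q (mainTheorem13 Π)
mainTheorem13 (m x k xs σ Π e p q)   = m-decomposes x k xs σ e p q (mainTheorem13 Π)
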